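{- Let $\Sigma$ be a finite alphabet with $0\in\Sigma$, let $A$ be a letter not in $\Sigma$, and let $L\subseteq\Sigma^\omega$ be accepted by a real-time Büchi $1$-counter automaton. Define $h:\Sigma^\omega\to(\Sigma\cup\{A\})^\omega$ by $$h(x)=A.0.x(1).A.0^2.x(2).A.0^3.x(3).A\cdots A.0^n.x(n).A.0^{n+1}.x(n+1).A\cdots$$ and let $\alpha=A.0.A.0^2.A.0^3.A\cdots A.0^n.A.0^{n+1}.A\cdots\in(\Sigma\cup\{A\})^\omega$. Then there exists an infinitary rational relation $R_1\subseteq(\Sigma\cup\{A\})^\omega\times(\Sigma\cup\{A\})^\omega$ such that for all $x\in\Sigma^\omega$: $x\in L$ iff $(h(x),\alpha)\in R_1$.
   Context: A 2-tape Büchi automaton is $\mathcal{T}=(K,\Sigma,\Gamma,\Delta,q_0,F)$ with $K$ finite, $\Delta$ a finite subset of $K\times\Sigma^\star\times\Gamma^\star\times K$, $q_0$ initial, $F\subseteq K$ accepting; a computation is an infinite sequence of transitions $(q_0,u_1,v_1,q_1),(q_1,u_2,v_2,q_2),\dots$, successful if some state of $F$ occurs infinitely often among the $q_i$; an infinitary rational relation is the set of pairs $(u_1u_2\cdots,v_1v_2\cdots)$ of infinite words arising from successful computations of some such automaton. A real-time Büchi $1$-counter automaton is $\mathcal{M}=(K,\Sigma,\Delta,q_0,F)$ with $\Delta\subseteq K\times\Sigma\times\{0,1\}\times K\times\{0,1,-1\}$: in configuration $(q,c)$, $c\in\mathbb{N}$, reading $a$, a transition $(q,a,i,q',j)$ with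 $i=0$ iff $c=0$ leads to $(q',c+j)$ (and $i=0$ forces $j\in\{0,1\}$); $\sigma\in\Sigma^\omega$ is accepted iff some run from $(q_0,0)$ on $\sigma$ visits $F$ infinitely often. -}

module Defs where

open import Data.Nat using (ℕ; zero; suc; _+_; _∸_; _≤_; _<_)
open import Data.Nat.Base using (_<ᵇ_)
open import Data.Bool using (Bool; true; false; if_then_else_)
open import Data.Fin using (Fin; fromℕ<)
open import Data.Fin.Subset using (Subset; _∈_)
open import Data.List using (List; length; lookup)
import Data.List.Membership.Propositional as LM
open import Data.Maybe using (Maybe; just; nothing)
open import Data.Product using (Σ; ∃; ∃-syntax; _×_; _,_; proj₁; proj₂)
open import Relation.Binary.PropositionalEquality using (_≡_; _≢_)
open import Function.Bundles using (_⇔_)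
open import Data.Empty using (⊥)

-- Infinite words over A, indexed from 0.
Word : Set → Set
Word A = ℕ → A

prefLen : {A : Set} → (ℕ → List A) → ℕ → ℕ
prefLen w zero    = 0
prefLen w (suc i) = prefLen w i + length (w i)

IsConcat : {A : Set} → (ℕ → List A) → Word A → Set
IsConcat w u =
  (∀ N → ∃[ i ] (N ≤ prefLen w i)) ×
  (∀ i j (lt : j < length (w i)) → u (prefLen w i + j) ≡ lookup (w i) (fromℕ< lt))

record TwoTape (S G : Set) : Set₁ where
  field
    nStates : ℕ
    Δ       : List (Fin nStates × List S × List G × Fin nStates)
    q₀      : Fin nStates
    F       : Subset nStates

module _ {S G : Set} (T : TwoTape S G) where
  open TwoTape T

  Trans : Set
  Trans = Fin nStates × List S × List G × Fin nStates

  src : Trans → Fin nStates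
  src (p , _ , _ , _) = p
  tgt : Trans → Fin nStates
  tgt (_ , _ , _ , q) = q
  inp : Trans → List S
  inp (_ , u , _ , _) = u
  out : Trans → List G
  out (_ , _ , v , _) = v

  IsComputation : (ℕ → Trans) → Set
  IsComputation τ =
    (∀ i → τ i LM.∈ Δ) × (src (τ 0) ≡ q₀) × (∀ i → tgt (τ i) ≡ src (τ (suc i)))

  Successful : (ℕ → Trans) → Set
  Successful τ = ∀ N → ∃[ i ] (N ≤ i × tgt (τ i) ∈ F)

  RelOf : Word S → Word G → Set
  RelOf u v = ∃[ τ ] (IsComputation τ × Successful τ ×
                      IsConcat (λ i → inp (τ i)) u × IsConcat (λ i → out (τ i)) v)

InfRational : {S G : Set} → (Word S → Word G → Set) → Set₁
InfRational {S} {G} R = Σ (TwoTape S G) λ T → ∀ u v → R u v ⇔ RelOf T u v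

data Move : Set where
  stay inc dec : Move   -- j = 0, 1, -1

applyMove : Move → ℕ → ℕ
applyMove stay c = c
applyMove inc  c = suc c
applyMove dec  c = c ∸ 1

-- the test bit i : false (i = 0) iff c = 0
isPos : ℕ → Bool
isPos zero    = false
isPos (suc _) = true

record OneCounter (S : Set) : Set₁ where
  field
    nStates : ℕ
    Δ       : List (Fin nStates × S × Bool × Fin nStates × Move)
    q₀      : Fin nStates
    F       : Subset nStates
    wf      : ∀ {p a q} → (p , a , false , q , dec) LM.∈ Δ → ⊥

module _ {S : Set} (M : OneCounter S) where
  open OneCounter M

  Config : Set
  Config = Fin nStates × ℕ

  Step : Config → S → Config → Set
  Step (q , c) a (q' , c') =
    ∃[ mv ] ((q , a , isPos c , q' , mv) LM.∈ Δ × c' ≡ applyMove mv c)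

  IsRun : Word S → (ℕ → Config) → Set
  IsRun σ ρ = (ρ 0 ≡ (q₀ , 0)) × (∀ i → Step (ρ i) (σ i) (ρ (suc i)))

  Accepts : Word S → Set
  Accepts σ = ∃[ ρ ] (IsRun σ ρ × (∀ N → ∃[ i ] (N ≤ i × proj₁ (ρ i) ∈ F)))

-- The words h(x) and α over Σ ∪ {A}, with Σ ∪ {A} = Maybe Σ, A = nothing,
-- and o : Σ the letter 0.  x is indexed from 0, so x(k+1) of the paper is x k.
-- Block k (k = 0,1,2,…) of h(x) is  A . 0^(k+1) . x(k+1)   (length k+3),
-- block k of α is  A . 0^(k+1)  (length k+2).
-- Positions are located by walking through the blocks: (k , j) = block k, offset j.

module _ {S : Set} (o : S) where

  hLetter : Word S → ℕ → ℕ → Maybe S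
  hLetter x k zero    = nothing
  hLetter x k (suc j) = if j <ᵇ suc k then just o else just (x k)

  hWalk : ℕ → ℕ → ℕ → ℕ × ℕ
  hWalk k j zero    = k , j
  hWalk k j (suc p) = if j <ᵇ suc (suc k) then hWalk k (suc j) p else hWalk (suc k) 0 p

  h : Word S → Word (Maybe S)
  h x n = hLetter x (proj₁ (hWalk 0 0 n)) (proj₂ (hWalk 0 0 n))

  αLetter : ℕ → ℕ → Maybe S
  αLetter k zero    = nothing
  αLetter k (suc j) = just o

  αWalk : ℕ → ℕ → ℕ → ℕ × ℕ
  αWalk k j zero    = k , j
  αWalk k j (suc p) = if j <ᵇ suc k then αWalk k (suc j) p else αWalk (suc k) 0 p

  α : Word (Maybe S)
  α n = αLetter (proj₁ (αWalk 0 0 n)) (proj₂ (αWalk 0 0 n))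

-- Given a real-time Büchi 1-counter automaton M, we build a 2-tape Büchi automaton 𝒯
-- that reads h(x) on its first tape and α on its second, and simulates one step of M
-- per block A 0^(k+1) x(k) of h(x).  The counter value c is encoded as a lag: when
-- block k of h(x) starts, 𝒯 has written all of α except the last c letters before
-- block k of α.  On the marker A, 𝒯 writes the next letter of α, which is the marker
-- exactly when c = 0, and so checks the zero test; on the k+1 zeros it copies α, once
-- silently for an increment; on x(k) it writes one extra 0 for a decrement.

module Submission where

open import Defs
open import Data.Nat
open import Data.Nat.Properties
open import Data.Bool using (Bool; true; false; if_then_else_; T)
open import Data.Maybe using (Maybe; just; nothing)
open import Data.Maybe.Properties using (just-injective)
open import Data.Product using (Σ; ∃-syntax; _×_; _,_; proj₁; proj₂)
open import Data.Unit using (⊤; tt)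
open import Data.Empty using (⊥; ⊥-elim)
open import Data.Sum using (_⊎_; inj₁; inj₂)
open import Data.Fin using (Fin; _↑ˡ_; _↑ʳ_; splitAt; fromℕ<)
open import Data.Fin.Properties using (splitAt-↑ˡ; splitAt-↑ʳ)
open import Data.Fin.Subset using (_∈_)
open import Data.List using (List; []; _∷_; length; lookup; concatMap; allFin)
import Data.List.Membership.Propositional as List
open import Data.List.Membership.Propositional.Properties using (∈-concatMap⁺; ∈-concatMap⁻; ∈-allFin; ∈-lookup)
open import Data.List.Relation.Unary.Any using (here; there; satisfied; index)
open import Data.List.Relation.Unary.Any.Properties using (lookup-index)
import Data.Vec as Vec
open import Data.Vec.Properties using (lookup∘tabulate; []=⇒lookup; lookup⇒[]=)
open import Function using (id; case_of_)
open import Function.Bundles using (_⇔_; mk⇔)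
open import Relation.Nullary using (¬_)
open import Relation.Nullary.Decidable using (does; dec-true; dec-false)
open import Relation.Binary.PropositionalEquality
open import Data.Nat.Tactic.RingSolver using (solve-∀)

<ᵇ-true : ∀ {m n} → m < n → (m <ᵇ n) ≡ true
<ᵇ-true {m} {n} m<n with m <ᵇ n | <⇒<ᵇ m<n
... | true | _ = refl

<ᵇ-false : ∀ {m n} → n ≤ m → (m <ᵇ n) ≡ false
<ᵇ-false {m} {n} n≤m with m <ᵇ n in eq
... | false = refl
... | true  = ⊥-elim (<⇒≱ (<ᵇ⇒< m n (subst T (sym eq) tt)) n≤m)

-- A word cut into consecutive blocks, block k occupying the offsets 0 … b k.
-- 'walk k j p' is the (block , offset) reached by advancing p positions from
-- offset j of block k; 'blockStart k' is the absolute position of block k.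
module Blocks (b : ℕ → ℕ) where

  walk : ℕ → ℕ → ℕ → ℕ × ℕ
  walk k j zero    = k , j
  walk k j (suc p) = if j <ᵇ b k then walk k (suc j) p else walk (suc k) 0 p

  next : ℕ × ℕ → ℕ × ℕ
  next (k , j) = if j <ᵇ b k then (k , suc j) else (suc k , 0)

  walk-suc : ∀ p k j → walk k j (suc p) ≡ next (walk k j p)
  walk-suc zero    k j = refl
  walk-suc (suc p) k j with j <ᵇ b k
  ... | true  = walk-suc p k (suc j)
  ... | false = walk-suc p (suc k) 0

  blockStart : ℕ → ℕ
  blockStart zero    = 0
  blockStart (suc k) = blockStart k + suc (b k)

  locate : ℕ → ℕ × ℕ
  locate = walk 0 0

  locate-suc : ∀ i → locate (suc i) ≡ next (locate i)
  locate-suc i = walk-suc i 0 0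

  locate-at : ∀ k j → j ≤ b k → locate (blockStart k + j) ≡ (k , j)
  locate-at zero    zero    _   = refl
  locate-at (suc k) zero    _   = begin
    locate (blockStart k + suc (b k) + 0)  ≡⟨ cong locate (+-identityʳ (blockStart k + suc (b k))) ⟩
    locate (blockStart k + suc (b k))      ≡⟨ cong locate (+-suc (blockStart k) (b k)) ⟩
    locate (suc (blockStart k + b k))      ≡⟨ locate-suc (blockStart k + b k) ⟩
    next (locate (blockStart k + b k))     ≡⟨ cong next (locate-at k (b k) ≤-refl) ⟩
    next (k , b k)                         ≡⟨ cong (if_then (k , suc (b k)) else (suc k , 0))
                                                   (<ᵇ-false {b k} ≤-refl) ⟩
    (suc k , 0)                            ∎
    where open ≡-Reasoning
  locate-at k       (suc j) j<b = begin
    locate (blockStart k + suc j)  ≡⟨ cong locate (+-suc (blockStart k) j) ⟩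
    locate (suc (blockStart k + j)) ≡⟨ locate-suc (blockStart k + j) ⟩
    next (locate (blockStart k + j)) ≡⟨ cong next (locate-at k j (<⇒≤ j<b)) ⟩
    next (k , j)                   ≡⟨ cong (if_then (k , suc j) else (suc k , 0)) (<ᵇ-true j<b) ⟩
    (k , suc j)                    ∎
    where open ≡-Reasoning

  locate-spec : ∀ i → let (k , j) = locate i in i ≡ blockStart k + j × j ≤ b k
  locate-spec zero = refl , z≤n
  locate-spec (suc i) rewrite locate-suc i with locate i | locate-spec i
  ... | k , j | i≡ , j≤b with j <ᵇ b k in eq
  ... | true  = trans (cong suc i≡) (sym (+-suc _ j)) , <ᵇ⇒< j (b k) (subst T (sym eq) tt)
  ... | false = (begin
      suc i                         ≡⟨ cong suc i≡ ⟩
      suc (blockStart k + j)        ≡⟨ sym (+-suc _ j) ⟩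
      blockStart k + suc j          ≡⟨ cong (λ z → blockStart k + suc z) j≡b ⟩
      blockStart k + suc (b k)      ≡⟨ sym (+-identityʳ _) ⟩
      blockStart k + suc (b k) + 0  ∎) , z≤n
    where
      open ≡-Reasoning
      j≡b : j ≡ b k
      j≡b = ≤-antisym j≤b (≮⇒≥ (λ j<b → subst T eq (<⇒<ᵇ j<b)))

  blockStart-mono : ∀ {k k'} → k ≤ k' → blockStart k ≤ blockStart k'
  blockStart-mono k≤k' = go (≤⇒≤′ k≤k')
    where
      go : ∀ {k k'} → k ≤′ k' → blockStart k ≤ blockStart k'
      go ≤′-refl      = ≤-refl
      go (≤′-step le) = ≤-trans (go le) (m≤m+n _ _)

  blockStart-≥ : (∀ k → suc k ≤ b k) → ∀ k → k + k ≤ blockStart k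
  blockStart-≥ long zero    = z≤n
  blockStart-≥ long (suc k) = begin
    suc k + suc k          ≡⟨ double-suc k ⟩
    k + k + 2              ≤⟨ +-mono-≤ (blockStart-≥ long k) (s≤s (≤-trans (s≤s z≤n) (long k))) ⟩
    blockStart k + suc (b k) ∎
    where
      open ≤-Reasoning
      double-suc : ∀ k → suc k + suc k ≡ k + k + 2
      double-suc = solve-∀

module hBlocks = Blocks (λ k → suc (suc k))
module αBlocks = Blocks suc

open hBlocks using () renaming (blockStart to hStart; locate to hLocate)
open αBlocks using () renaming (blockStart to αStart)

module Letters {S : Set} (o : S) where

  hWalk≡walk : ∀ p k j → hWalk o k j p ≡ hBlocks.walk k j p
  hWalk≡walk zero    k j = refl
  hWalk≡walk (suc p) k j with j <ᵇ suc (suc k)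
  ... | true  = hWalk≡walk p k (suc j)
  ... | false = hWalk≡walk p (suc k) 0

  αWalk≡walk : ∀ p k j → αWalk o k j p ≡ αBlocks.walk k j p
  αWalk≡walk zero    k j = refl
  αWalk≡walk (suc p) k j with j <ᵇ suc k
  ... | true  = αWalk≡walk p k (suc j)
  ... | false = αWalk≡walk p (suc k) 0

  h-located : ∀ x i → h o x i ≡ hLetter o x (proj₁ (hLocate i)) (proj₂ (hLocate i))
  h-located x i = cong (λ (k , j) → hLetter o x k j) (hWalk≡walk i 0 0)

  h-at : ∀ x k j → j ≤ suc (suc k) → h o x (hStart k + j) ≡ hLetter o x k j
  h-at x k j j≤ = trans (h-located x (hStart k + j))
                        (cong (λ (k , j) → hLetter o x k j) (hBlocks.locate-at k j j≤))

  α-at : ∀ k j → j ≤ suc k → α o (αStart k + j) ≡ αLetter o k j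
  α-at k j j≤ = cong (λ (k , j) → αLetter o k j)
                     (trans (αWalk≡walk (αStart k + j) 0 0) (αBlocks.locate-at k j j≤))

  h-marker : ∀ x k → h o x (hStart k) ≡ nothing
  h-marker x k = trans (cong (h o x) (sym (+-identityʳ (hStart k)))) (h-at x k 0 z≤n)

  h-zero : ∀ x k j → j ≤ k → h o x (hStart k + suc j) ≡ just o
  h-zero x k j j≤k rewrite h-at x k (suc j) (s≤s (m≤n⇒m≤1+n j≤k)) | <ᵇ-true {j} {suc k} (s≤s j≤k) = refl

  h-letter : ∀ x k → h o x (hStart k + suc (suc k)) ≡ just (x k)
  h-letter x k rewrite h-at x k (suc (suc k)) ≤-refl | <ᵇ-false {suc k} {suc k} ≤-refl = refl

  h-inner : ∀ x k j → j ≤ suc k → ∃[ a ] h o x (hStart k + suc j) ≡ just a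
  h-inner x k j j≤ with m≤n⇒m<n∨m≡n j≤
  ... | inj₁ j<  = o , h-zero x k j (≤-pred j<)
  ... | inj₂ refl = x k , h-letter x k

  h-marker-only : ∀ x i → h o x i ≡ nothing → proj₂ (hLocate i) ≡ 0
  h-marker-only x i hi≡A with hLocate i | h-located x i
  ... | k , zero  | _ = refl
  ... | k , suc j | hi≡ with j <ᵇ suc k
  ...   | true  = case trans (sym hi≡) hi≡A of λ ()
  ...   | false = case trans (sym hi≡) hi≡A of λ ()

  α-marker : ∀ k → α o (αStart k) ≡ nothing
  α-marker k = trans (cong (α o) (sym (+-identityʳ (αStart k)))) (α-at k 0 z≤n)

  α-zero : ∀ k j → j ≤ k → α o (αStart k + suc j) ≡ just o
  α-zero k j j≤k = α-at k (suc j) (s≤s j≤k)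

  -- The letter of α lagging c positions behind offset r of block k: the marker
  -- exactly when r = c, since α has no other marker within distance k + 1.
  lagLetter : ℕ → ℕ → Maybe S
  lagLetter r c = if does (r ≟ c) then nothing else just o

  private
    α-lag-ahead : ∀ {k c d O} → O + c ≡ αStart k + suc (c + d) → suc (c + d) ≤ suc k → α o O ≡ just o
    α-lag-ahead {k} {c} {d} {O} eq r≤ = trans (cong (α o) O≡) (α-zero k d (m+n≤o⇒n≤o c (≤-pred r≤)))
      where
        rearrange : ∀ a c d → a + suc (c + d) ≡ a + suc d + c
        rearrange = solve-∀
        O≡ : O ≡ αStart k + suc d
        O≡ = +-cancelʳ-≡ c O (αStart k + suc d) (trans eq (rearrange (αStart k) c d))

    α-lag-behind : ∀ {k r e O} → O + suc (r + e) ≡ αStart (suc k) + r → r + e ≤ k → α o O ≡ just o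
    α-lag-behind {k} {r} {e} {O} eq r+e≤k = trans (cong (α o) O≡) (α-zero k (k ∸ e) (m∸n≤m k e))
      where
        open ≡-Reasoning
        rearrange : ∀ a r e d → a + suc (suc (e + d)) + r ≡ a + suc d + suc (r + e)
        rearrange = solve-∀
        O≡ : O ≡ αStart k + suc (k ∸ e)
        O≡ = +-cancelʳ-≡ (suc (r + e)) O (αStart k + suc (k ∸ e)) (begin
          O + suc (r + e)                          ≡⟨ eq ⟩
          αStart k + suc (suc k) + r               ≡⟨ cong (λ z → αStart k + suc (suc z) + r)
                                                           (sym (m+[n∸m]≡n (m+n≤o⇒n≤o r r+e≤k))) ⟩
          αStart k + suc (suc (e + (k ∸ e))) + r   ≡⟨ rearrange (αStart k) r e (k ∸ e) ⟩
          αStart k + suc (k ∸ e) + suc (r + e)     ∎)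

  α-lag : ∀ {k c r O} → O + c ≡ αStart k + r → c ≤ k → r ≤ suc k → α o O ≡ lagLetter r c
  α-lag {k} {c} {r} {O} eq c≤k r≤ with compare r c
  ... | equal _ rewrite dec-true (r ≟ r) refl =
    trans (cong (α o) (+-cancelʳ-≡ r O (αStart k) eq)) (α-marker k)
  ... | greater _ d rewrite dec-false (suc (c + d) ≟ c) (λ e → <⇒≢ (s≤s (m≤m+n c d)) (sym e)) =
    α-lag-ahead {k} {c} {d} {O} eq r≤
  α-lag {suc k} {_} {r} {O} eq (s≤s r+e≤k) r≤ | less _ e
    rewrite dec-false (r ≟ suc (r + e)) (λ e' → <⇒≢ (s≤s (m≤m+n r e)) e') =
    α-lag-behind {k} {r} {e} {O} eq r+e≤k

data Offset (k : ℕ) : ℕ → Set where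
  atMark     : Offset k 0
  atZero     : ∀ {j} → j < k → Offset k (suc j)
  atLastZero : Offset k (suc k)
  atLetter   : Offset k (suc (suc k))

offset : ∀ {k j} → j ≤ suc (suc k) → Offset k j
offset {k} {zero}  _  = atMark
offset {k} {suc j} le with m≤n⇒m<n∨m≡n (≤-pred le)
... | inj₂ refl = atLetter
... | inj₁ j<   with m≤n⇒m<n∨m≡n (≤-pred j<)
...   | inj₂ refl = atLastZero
...   | inj₁ j<k  = atZero j<k

applyMove-≤ : ∀ mv c → applyMove mv c ≤ suc c
applyMove-≤ stay c = n≤1+n c
applyMove-≤ inc  c = ≤-refl
applyMove-≤ dec  c = ≤-trans (m∸n≤m c 1) (n≤1+n c)

concat-singleton : ∀ {A : Set} {w : ℕ → List A} {u : Word A} → IsConcat w u →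
  ∀ i {ℓ} → w i ≡ ℓ ∷ [] → u (prefLen w i) ≡ ℓ
concat-singleton {w = w} {u} (_ , agree) i {ℓ} wi≡ =
  trans (cong u (sym (+-identityʳ (prefLen w i)))) (trans (agree i 0 0<len) (head≡ (w i) wi≡ 0<len))
  where
    0<len : 0 < length (w i)
    0<len = subst (λ v → 0 < length v) (sym wi≡) (s≤s z≤n)
    head≡ : ∀ v → v ≡ ℓ ∷ [] → (lt : 0 < length v) → lookup v (fromℕ< lt) ≡ ℓ
    head≡ _ refl (s≤s z≤n) = refl

+1≡suc : ∀ a j → a + j + 1 ≡ a + suc j
+1≡suc a j = trans (+-assoc a j 1) (cong (a +_) (+-comm j 1))

WritesAt : ∀ {A : Set} → Word A → ℕ → List A → Set
WritesAt u O []            = ⊤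
WritesAt u O (ℓ ∷ [])      = u O ≡ ℓ
WritesAt u O (_ ∷ _ ∷ _)   = ⊥

writesAt-agree : ∀ {A : Set} {u : Word A} {O} w → WritesAt u O w →
  ∀ j (lt : j < length w) → u (O + j) ≡ lookup w (fromℕ< lt)
writesAt-agree {u = u} {O} (ℓ ∷ []) uO≡ zero (s≤s z≤n) = trans (cong u (+-identityʳ O)) uO≡

module Construction (n : ℕ) (o : Fin n) (M : OneCounter (Fin n)) where
  open OneCounter M renaming (nStates to nQ; Δ to ΔM; q₀ to q₀M; F to FM; wf to wfM)
  open Letters o

  L : Set
  L = Maybe (Fin n)

  m : ℕ
  m = length ΔM

  srcM tgtM : Fin m → Fin nQ
  srcM t = proj₁ (lookup ΔM t)
  tgtM t = proj₁ (proj₂ (proj₂ (proj₂ (lookup ΔM t))))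
  letM : Fin m → Fin n
  letM t = proj₁ (proj₂ (lookup ΔM t))
  testM : Fin m → Bool
  testM t = proj₁ (proj₂ (proj₂ (lookup ΔM t)))
  movM : Fin m → Move
  movM t = proj₂ (proj₂ (proj₂ (proj₂ (lookup ΔM t))))

  ∈ΔM : ∀ t {q a b mv} → srcM t ≡ q → letM t ≡ a → testM t ≡ b → movM t ≡ mv →
        (q , a , b , tgtM t , mv) List.∈ ΔM
  ∈ΔM t refl refl refl refl = ∈-lookup t

  dec-positive : ∀ {q a c q'} → (q , a , isPos c , q' , dec) List.∈ ΔM → ∃[ c₀ ] c ≡ suc c₀
  dec-positive {c = zero}   mem = ⊥-elim (wfM mem)
  dec-positive {c = suc c₀} _   = c₀ , refl

  -- Reading block k of h(x) it simulates one step
  -- of M: at the marker it guesses the transition t, then it reads the 0s, and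
  -- for an incrementing t one of them is read silently (state 'skipped t').
  data St : Set where
    atMarker : Fin nQ → St
    reading skipped : Fin m → St

  nT : ℕ
  nT = nQ + (m + m)

  enc : St → Fin nT
  enc (atMarker q) = q ↑ˡ (m + m)
  enc (reading t)  = nQ ↑ʳ (t ↑ˡ m)
  enc (skipped t)  = nQ ↑ʳ (m ↑ʳ t)

  decode : Fin nT → St
  decode p with splitAt nQ p
  ... | inj₁ q = atMarker q
  ... | inj₂ r with splitAt m r
  ...   | inj₁ t = reading t
  ...   | inj₂ t = skipped t

  decode-enc : ∀ s → decode (enc s) ≡ s
  decode-enc (atMarker q) rewrite splitAt-↑ˡ nQ q (m + m) = refl
  decode-enc (reading t)  rewrite splitAt-↑ʳ nQ (m + m) (t ↑ˡ m) | splitAt-↑ˡ m t m = refl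
  decode-enc (skipped t)  rewrite splitAt-↑ʳ nQ (m + m) (m ↑ʳ t) | splitAt-↑ʳ m m t = refl

  IsMarker : St → Set
  IsMarker (atMarker _) = ⊤
  IsMarker _            = ⊥

  -- The output on a marker reveals the zero test: the marker A of α is met
  -- exactly when the simulated counter is 0 (see lagLetter).
  testLetter : Bool → L
  testLetter false = nothing
  testLetter true  = just o

  testLetter-lag : ∀ b c → testLetter b ≡ lagLetter 0 c → b ≡ isPos c
  testLetter-lag false zero    _ = refl
  testLetter-lag true  (suc c) _ = refl
  testLetter-lag false (suc c) ()
  testLetter-lag true  zero    ()

  testLetter-isPos : ∀ c → testLetter (isPos c) ≡ lagLetter 0 c
  testLetter-isPos zero    = refl
  testLetter-isPos (suc c) = refl

  -- The output lags behind the start of the current α-block by the counter value: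
  -- a block writes k+2 letters for 'stay', one more for 'dec', one fewer for 'inc'.
  data Rule : St → L → List L → St → Set where
    marker   : ∀ t → Rule (atMarker (srcM t)) nothing (testLetter (testM t) ∷ []) (reading t)
    zero-0   : ∀ t → Rule (reading t) (just o) (just o ∷ []) (reading t)
    zero-A   : ∀ t → Rule (reading t) (just o) (nothing ∷ []) (reading t)
    skip     : ∀ t → movM t ≡ inc → Rule (reading t) (just o) [] (skipped t)
    end-stay : ∀ t → movM t ≡ stay → Rule (reading t) (just (letM t)) [] (atMarker (tgtM t))
    end-dec  : ∀ t → movM t ≡ dec → Rule (reading t) (just (letM t)) (just o ∷ []) (atMarker (tgtM t))
    end-inc  : ∀ t → movM t ≡ inc → Rule (skipped t) (just (letM t)) [] (atMarker (tgtM t))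

  recast : ∀ {s₁ s₂ ℓ₁ ℓ₂ w s₁' s₂'} → s₁ ≡ s₂ → ℓ₁ ≡ ℓ₂ → s₁' ≡ s₂' →
           Rule s₁ ℓ₁ w s₁' → Rule s₂ ℓ₂ w s₂'
  recast refl refl refl r = r

  TrT : Set
  TrT = Fin nT × List L × List L × Fin nT

  ⟦_⟧ : ∀ {s ℓ w s'} → Rule s ℓ w s' → TrT
  ⟦_⟧ {s} {ℓ} {w} {s'} _ = enc s , ℓ ∷ [] , w , enc s'

  endRules : ∀ t mv → movM t ≡ mv → List TrT
  endRules t stay eq = ⟦ end-stay t eq ⟧ ∷ []
  endRules t dec  eq = ⟦ end-dec t eq ⟧ ∷ []
  endRules t inc  eq = ⟦ skip t eq ⟧ ∷ ⟦ end-inc t eq ⟧ ∷ []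

  rulesOf : Fin m → List TrT
  rulesOf t = ⟦ marker t ⟧ ∷ ⟦ zero-0 t ⟧ ∷ ⟦ zero-A t ⟧ ∷ endRules t (movM t) refl

  accepting : St → Bool
  accepting (atMarker q) = Vec.lookup FM q
  accepting _            = false

  𝒯 : TwoTape L L
  𝒯 = record
    { nStates = nT
    ; Δ       = concatMap rulesOf (allFin m)
    ; q₀      = enc (atMarker q₀M)
    ; F       = Vec.tabulate (λ p → accepting (decode p))
    }

  open TwoTape 𝒯 using (Δ; F)

  rule-∈Δ : ∀ {s ℓ w s'} (r : Rule s ℓ w s') → ⟦ r ⟧ List.∈ Δ
  rule-∈Δ r = let (t , r∈) = ∈rulesOf r in ∈-concatMap⁺ rulesOf (List.lose (∈-allFin t) r∈)
    where
      ∈endRules : ∀ {e} t mv (eq : movM t ≡ mv) → e List.∈ endRules t mv eq → e List.∈ rulesOf t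
      ∈endRules t mv refl e∈ = there (there (there e∈))
      ∈rulesOf : ∀ {s ℓ w s'} (r : Rule s ℓ w s') → ∃[ t ] ⟦ r ⟧ List.∈ rulesOf t
      ∈rulesOf (marker t)      = t , here refl
      ∈rulesOf (zero-0 t)      = t , there (here refl)
      ∈rulesOf (zero-A t)      = t , there (there (here refl))
      ∈rulesOf (skip t eq)     = t , ∈endRules t inc eq (here refl)
      ∈rulesOf (end-stay t eq) = t , ∈endRules t stay eq (here refl)
      ∈rulesOf (end-dec t eq)  = t , ∈endRules t dec eq (here refl)
      ∈rulesOf (end-inc t eq)  = t , ∈endRules t inc eq (there (here refl))

  data Encodes : TrT → Set where
    ⟨_⟩ : ∀ {s ℓ w s'} (r : Rule s ℓ w s') → Encodes ⟦ r ⟧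

  ∈Δ-rule : ∀ {e} → e List.∈ Δ → Encodes e
  ∈Δ-rule e∈ = let (t , e∈t) = satisfied (∈-concatMap⁻ rulesOf {xs = allFin m} e∈) in ∈rulesOf t e∈t
    where
      ∈endRules : ∀ {e} t mv (eq : movM t ≡ mv) → e List.∈ endRules t mv eq → Encodes e
      ∈endRules t stay eq (here refl)         = ⟨ end-stay t eq ⟩
      ∈endRules t dec  eq (here refl)         = ⟨ end-dec t eq ⟩
      ∈endRules t inc  eq (here refl)         = ⟨ skip t eq ⟩
      ∈endRules t inc  eq (there (here refl)) = ⟨ end-inc t eq ⟩
      ∈rulesOf : ∀ {e} t → e List.∈ rulesOf t → Encodes e
      ∈rulesOf t (here refl)                 = ⟨ marker t ⟩
      ∈rulesOf t (there (here refl))         = ⟨ zero-0 t ⟩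
      ∈rulesOf t (there (there (here refl))) = ⟨ zero-A t ⟩
      ∈rulesOf t (there (there (there e∈)))  = ∈endRules t (movM t) refl e∈

  decoded : ∀ {e} → Encodes e →
    ∃[ ℓ ] (inp 𝒯 e ≡ ℓ ∷ [] × Rule (decode (src 𝒯 e)) ℓ (out 𝒯 e) (decode (tgt 𝒯 e)))
  decoded (⟨_⟩ {s} {ℓ} {w} {s'} r) =
    ℓ , refl , subst₂ (λ a b → Rule a ℓ w b) (sym (decode-enc s)) (sym (decode-enc s')) r

  accepting-marker : ∀ s → accepting s ≡ true → ∃[ q ] (s ≡ atMarker q × Vec.lookup FM q ≡ true)
  accepting-marker (atMarker q) acc = q , refl , acc

  accepting⇒∈F : ∀ s → accepting s ≡ true → enc s ∈ F
  accepting⇒∈F s acc = lookup⇒[]= (enc s) F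
    (trans (lookup∘tabulate (λ p → accepting (decode p)) (enc s)) (trans (cong accepting (decode-enc s)) acc))

  ∈F⇒accepting : ∀ p → p ∈ F → accepting (decode p) ≡ true
  ∈F⇒accepting p p∈ = trans (sym (lookup∘tabulate (λ p → accepting (decode p)) p)) ([]=⇒lookup p∈)

  fromMarker : ∀ {q ℓ w s'} → Rule (atMarker q) ℓ w s' →
    ∃[ t ] (srcM t ≡ q × ℓ ≡ nothing × w ≡ testLetter (testM t) ∷ [] × s' ≡ reading t)
  fromMarker (marker t) = t , refl , refl , refl , refl

  reads-A⇒marker : ∀ {s w s'} → Rule s nothing w s' → IsMarker s
  reads-A⇒marker (marker t) = _

  reads-letter⇒¬marker : ∀ {s a w s'} → Rule s (just a) w s' → ¬ IsMarker s
  reads-letter⇒¬marker {atMarker q} r _ with fromMarker r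
  ... | _ , _ , () , _

  readingInner : ∀ {t ℓ w s'} → Rule (reading t) ℓ w s' → ¬ IsMarker s' →
    (s' ≡ reading t × length w ≡ 1) ⊎ (s' ≡ skipped t × movM t ≡ inc × length w ≡ 0)
  readingInner (zero-0 t)      _  = inj₁ (refl , refl)
  readingInner (zero-A t)      _  = inj₁ (refl , refl)
  readingInner (skip t eq)     _  = inj₂ (refl , eq , refl)
  readingInner (end-stay t _) ¬m = ⊥-elim (¬m _)
  readingInner (end-dec t _)  ¬m = ⊥-elim (¬m _)

  readingEnd : ∀ {t ℓ w s'} → Rule (reading t) ℓ w s' → IsMarker s' →
    ℓ ≡ just (letM t) × s' ≡ atMarker (tgtM t) ×
    ((movM t ≡ stay × length w ≡ 0) ⊎ (movM t ≡ dec × length w ≡ 1))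
  readingEnd (end-stay t eq) _ = refl , refl , inj₁ (eq , refl)
  readingEnd (end-dec t eq)  _ = refl , refl , inj₂ (eq , refl)

  fromSkipped : ∀ {t ℓ w s'} → Rule (skipped t) ℓ w s' →
    movM t ≡ inc × ℓ ≡ just (letM t) × length w ≡ 0 × s' ≡ atMarker (tgtM t)
  fromSkipped (end-inc t eq) = eq , refl , refl , refl

  lastState : Fin m → Move → St
  lastState t inc = skipped t
  lastState t _   = reading t

  lastZeroOut : Move → L → List L
  lastZeroOut inc ℓ = []
  lastZeroOut _   ℓ = ℓ ∷ []

  endOut : Move → List L
  endOut dec = just o ∷ []
  endOut _   = []

  zeroRule : ∀ t r c → Rule (reading t) (just o) (lagLetter r c ∷ []) (reading t)
  zeroRule t r c with does (r ≟ c)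
  ... | true  = zero-A t
  ... | false = zero-0 t

  lastZeroRule : ∀ t mv r c → movM t ≡ mv →
                 Rule (reading t) (just o) (lastZeroOut mv (lagLetter r c)) (lastState t mv)
  lastZeroRule t stay r c _  = zeroRule t r c
  lastZeroRule t dec  r c _  = zeroRule t r c
  lastZeroRule t inc  r c eq = skip t eq

  endRule : ∀ t mv → movM t ≡ mv → Rule (lastState t mv) (just (letM t)) (endOut mv) (atMarker (tgtM t))
  endRule t stay eq = end-stay t eq
  endRule t dec  eq = end-dec t eq
  endRule t inc  eq = end-inc t eq

  lastZero-writes : ∀ {u : Word L} {O ℓ} mv → u O ≡ ℓ → WritesAt u O (lastZeroOut mv ℓ)
  lastZero-writes stay uO≡ = uO≡
  lastZero-writes dec  uO≡ = uO≡
  lastZero-writes inc  _   = _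

  balance : ∀ mv c ℓ → (mv ≡ dec → ∃[ c₀ ] c ≡ suc c₀) →
            length (lastZeroOut mv ℓ) + length (endOut mv) + applyMove mv c ≡ suc c
  balance stay c ℓ _   = refl
  balance inc  c ℓ _   = refl
  balance dec  c ℓ pos with pos refl
  ... | c₀ , refl = refl

  -- Block k of the computation simulates the k-th step of M; the invariant 'Sim k'
  -- at the start of block k records the simulated configuration (q , c).
  module Soundness (x : Word (Fin n)) (τ : ℕ → TrT) (comp : IsComputation 𝒯 τ) (success : Successful 𝒯 τ)
                   (inputs : IsConcat (λ i → inp 𝒯 (τ i)) (h o x))
                   (outputs : IsConcat (λ i → out 𝒯 (τ i)) (α o)) where

    state : ℕ → St
    state i = decode (src 𝒯 (τ i))

    output : ℕ → List L
    output i = out 𝒯 (τ i)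

    outPos : ℕ → ℕ
    outPos = prefLen output

    private
      decodedAt : ∀ i → ∃[ ℓ ] (inp 𝒯 (τ i) ≡ ℓ ∷ [] × Rule (state i) ℓ (output i) (state (suc i)))
      decodedAt i with decoded (∈Δ-rule (proj₁ comp i))
      ... | ℓ , inp≡ , r = ℓ , inp≡ , recast refl refl (cong decode (proj₂ (proj₂ comp) i)) r

      -- 𝒯 reads one letter per transition
      inPos≡ : ∀ i → prefLen (λ i → inp 𝒯 (τ i)) i ≡ i
      inPos≡ zero    = refl
      inPos≡ (suc i) = trans (cong₂ _+_ (inPos≡ i) (cong length (proj₁ (proj₂ (decodedAt i))))) (+-comm i 1)

    ruleAt : ∀ i → Rule (state i) (h o x i) (output i) (state (suc i))
    ruleAt i with decodedAt i
    ... | ℓ , inp≡ , r = subst (λ a → Rule (state i) a (output i) (state (suc i))) (sym hi≡ℓ) r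
      where
        hi≡ℓ : h o x i ≡ ℓ
        hi≡ℓ = trans (cong (h o x) (sym (inPos≡ i))) (concat-singleton {u = h o x} inputs i inp≡)

    ruleIn : ∀ k j → Rule (state (hStart k + j)) (h o x (hStart k + j)) (output (hStart k + j))
                          (state (hStart k + suc j))
    ruleIn k j = recast refl refl (cong state (sym (+-suc (hStart k) j))) (ruleAt (hStart k + j))

    outPos-in : ∀ k j → outPos (hStart k + suc j) ≡ outPos (hStart k + j) + length (output (hStart k + j))
    outPos-in k j = cong outPos (+-suc (hStart k) j)

    marker-at : ∀ k → IsMarker (state (hStart k))
    marker-at k = reads-A⇒marker (recast refl (h-marker x k) refl (ruleAt (hStart k)))

    inner-at : ∀ k j → j ≤ suc k → ¬ IsMarker (state (hStart k + suc j))
    inner-at k j j≤ with h-inner x k j j≤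
    ... | a , hi≡ = reads-letter⇒¬marker (recast refl hi≡ refl (ruleAt (hStart k + suc j)))

    letter≡ : ∀ {k t} → h o x (hStart k + suc (suc k)) ≡ just (letM t) → letM t ≡ x k
    letter≡ {k} ℓ≡ = just-injective (trans (sym ℓ≡) (h-letter x k))

    record Sim (k : ℕ) : Set where
      field
        q       : Fin nQ
        c       : ℕ
        atStart : state (hStart k) ≡ atMarker q
        lag     : outPos (hStart k) + c ≡ αStart k
        c≤k     : c ≤ k
    open Sim

    data Inside (k : ℕ) (t : Fin m) (j : ℕ) : Set where
      inReading : state (hStart k + j) ≡ reading t →
                  outPos (hStart k + j) ≡ outPos (hStart k) + j → Inside k t j
      inSkipped : state (hStart k + j) ≡ skipped t → movM t ≡ inc →
                  outPos (hStart k + j) + 1 ≡ outPos (hStart k) + j → Inside k t j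

    -- reading the marker fixes the simulated transition t, whose zero test is
    -- forced by the letter of α written at the lagging output position
    markerPhase : ∀ {k} (b : Sim k) → ∃[ t ] (srcM t ≡ q b × testM t ≡ isPos (c b) × Inside k t 1)
    markerPhase {k} b with fromMarker (recast (atStart b) refl refl (ruleAt (hStart k)))
    ... | t , src≡ , _ , out≡ , next≡ = t , src≡ , test≡ , inReading state1 outPos1
      where
        test≡ : testM t ≡ isPos (c b)
        test≡ = testLetter-lag (testM t) (c b) (begin
          testLetter (testM t)    ≡⟨ sym (concat-singleton {u = α o} outputs (hStart k) out≡) ⟩
          α o (outPos (hStart k)) ≡⟨ α-lag (trans (lag b) (sym (+-identityʳ (αStart k)))) (c≤k b) z≤n ⟩
          lagLetter 0 (c b)       ∎)
          where open ≡-Reasoning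
        state1 : state (hStart k + 1) ≡ reading t
        state1 = trans (cong state (+-comm (hStart k) 1)) next≡
        outPos1 : outPos (hStart k + 1) ≡ outPos (hStart k) + 1
        outPos1 = trans (cong outPos (+-comm (hStart k) 1)) (cong (outPos (hStart k) +_) (cong length out≡))

    insideStep : ∀ {k t j} → j ≤ k → Inside k t (suc j) → Inside k t (suc (suc j))
    insideStep {k} {t} {j} j≤k (inReading st pos)
      with readingInner (recast st refl refl (ruleIn k (suc j))) (inner-at k (suc j) (s≤s j≤k))
    ... | inj₁ (st' , len1) = inReading st' (begin
      outPos (hStart k + suc (suc j))    ≡⟨ outPos-in k (suc j) ⟩
      outPos (hStart k + suc j) + length (output (hStart k + suc j)) ≡⟨ cong₂ _+_ pos len1 ⟩
      outPos (hStart k) + suc j + 1      ≡⟨ +1≡suc (outPos (hStart k)) (suc j) ⟩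
      outPos (hStart k) + suc (suc j)    ∎)
      where open ≡-Reasoning
    ... | inj₂ (st' , isInc , len0) = inSkipped st' isInc (begin
      outPos (hStart k + suc (suc j)) + 1 ≡⟨ cong (_+ 1) (outPos-in k (suc j)) ⟩
      outPos (hStart k + suc j) + length (output (hStart k + suc j)) + 1
                                          ≡⟨ cong (λ l → outPos (hStart k + suc j) + l + 1) len0 ⟩
      outPos (hStart k + suc j) + 0 + 1   ≡⟨ cong (λ p → p + 1) (trans (+-identityʳ _) pos) ⟩
      outPos (hStart k) + suc j + 1       ≡⟨ +1≡suc (outPos (hStart k)) (suc j) ⟩
      outPos (hStart k) + suc (suc j)     ∎)
      where open ≡-Reasoning
    insideStep {k} {t} {j} j≤k (inSkipped st _ _) with fromSkipped (recast st refl refl (ruleIn k (suc j)))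
    ... | _ , _ , _ , next≡ = ⊥-elim (inner-at k (suc j) (s≤s j≤k) (subst IsMarker (sym next≡) _))

    insideAll : ∀ {k t} → Inside k t 1 → ∀ j → j ≤ suc k → Inside k t (suc j)
    insideAll start zero    _   = start
    insideAll start (suc j) j<  = insideStep (≤-pred j<) (insideAll start j (m≤n⇒m≤1+n (≤-pred j<)))

    nextSim : ∀ {k} (b : Sim k) q' c' → state (hStart (suc k)) ≡ atMarker q' →
              outPos (hStart (suc k)) + c' ≡ outPos (hStart k) + suc (suc k) + c b → c' ≤ suc k → Sim (suc k)
    nextSim {k} b q' c' st lag≡ c'≤ = record { q = q' ; c = c' ; atStart = st ; lag = lag' ; c≤k = c'≤ }
      where
        swap : ∀ a b c → a + b + c ≡ a + c + b
        swap = solve-∀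
        lag' : outPos (hStart (suc k)) + c' ≡ αStart k + suc (suc k)
        lag' = trans lag≡ (trans (swap (outPos (hStart k)) (suc (suc k)) (c b)) (cong (_+ suc (suc k)) (lag b)))

    SimStep : ∀ k → Sim k → Set
    SimStep k b = Σ (Sim (suc k)) λ b' → Step M (q b , c b) (x k) (q b' , c b')

    endReading : ∀ {k t} (b : Sim k) → srcM t ≡ q b → testM t ≡ isPos (c b) →
                 state (hStart k + suc (suc k)) ≡ reading t →
                 outPos (hStart k + suc (suc k)) ≡ outPos (hStart k) + suc (suc k) → SimStep k b
    endReading {k} {t} b src≡ test≡ st pos
      with readingEnd (recast st refl refl (ruleIn k (suc (suc k)))) (marker-at (suc k))
    ... | ℓ≡ , next≡ , inj₁ (isStay , len0) =
      nextSim b (tgtM t) (c b) next≡ lag≡ (m≤n⇒m≤1+n (c≤k b)) ,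
      stay , ∈ΔM t src≡ (letter≡ {k} ℓ≡) test≡ isStay , refl
      where
        lag≡ : outPos (hStart (suc k)) + c b ≡ outPos (hStart k) + suc (suc k) + c b
        lag≡ = cong (_+ c b) (trans (outPos-in k (suc (suc k))) (trans (cong₂ _+_ pos len0) (+-identityʳ _)))
    ... | ℓ≡ , next≡ , inj₂ (isDec , len1) with dec-positive (∈ΔM t src≡ (letter≡ {k} ℓ≡) test≡ isDec)
    ...   | c₀ , c≡ =
      nextSim b (tgtM t) c₀ next≡ lag≡ c₀≤ ,
      dec , ∈ΔM t src≡ (letter≡ {k} ℓ≡) test≡ isDec , cong (_∸ 1) (sym c≡)
      where
        O = outPos (hStart k) + suc (suc k)
        c₀≤ : c₀ ≤ suc k
        c₀≤ = ≤-trans (n≤1+n c₀) (≤-trans (≤-reflexive (sym c≡)) (m≤n⇒m≤1+n (c≤k b)))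
        lag≡ : outPos (hStart (suc k)) + c₀ ≡ O + c b
        lag≡ = begin
          outPos (hStart (suc k)) + c₀ ≡⟨ cong (_+ c₀) (trans (outPos-in k (suc (suc k))) (cong₂ _+_ pos len1)) ⟩
          O + 1 + c₀                   ≡⟨ +-assoc O 1 c₀ ⟩
          O + suc c₀                   ≡⟨ cong (O +_) (sym c≡) ⟩
          O + c b                      ∎
          where open ≡-Reasoning

    endSkipped : ∀ {k t} (b : Sim k) → srcM t ≡ q b → testM t ≡ isPos (c b) →
                 state (hStart k + suc (suc k)) ≡ skipped t →
                 outPos (hStart k + suc (suc k)) + 1 ≡ outPos (hStart k) + suc (suc k) → SimStep k b
    endSkipped {k} {t} b src≡ test≡ st pos with fromSkipped (recast st refl refl (ruleIn k (suc (suc k))))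
    ... | isInc , ℓ≡ , len0 , next≡ =
      nextSim b (tgtM t) (suc (c b)) next≡ lag≡ (s≤s (c≤k b)) ,
      inc , ∈ΔM t src≡ (letter≡ {k} ℓ≡) test≡ isInc , refl
      where
        E = outPos (hStart k + suc (suc k))
        lag≡ : outPos (hStart (suc k)) + suc (c b) ≡ outPos (hStart k) + suc (suc k) + c b
        lag≡ = begin
          outPos (hStart (suc k)) + suc (c b) ≡⟨ cong (_+ suc (c b)) (trans (outPos-in k (suc (suc k)))
                                                                           (trans (cong (E +_) len0) (+-identityʳ E))) ⟩
          E + suc (c b)                       ≡⟨ sym (+-assoc E 1 (c b)) ⟩
          E + 1 + c b                         ≡⟨ cong (_+ c b) pos ⟩
          outPos (hStart k) + suc (suc k) + c b ∎
          where open ≡-Reasoning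

    blockEnd : ∀ {k t} (b : Sim k) → srcM t ≡ q b → testM t ≡ isPos (c b) →
               Inside k t (suc (suc k)) → SimStep k b
    blockEnd b src≡ test≡ (inReading st pos)   = endReading b src≡ test≡ st pos
    blockEnd b src≡ test≡ (inSkipped st _ pos) = endSkipped b src≡ test≡ st pos

    block : ∀ k (b : Sim k) → SimStep k b
    block k b with markerPhase b
    ... | t , src≡ , test≡ , start = blockEnd b src≡ test≡ (insideAll start (suc k) ≤-refl)

    sim : ∀ k → Sim k
    sim zero    = record { q = q₀M ; c = 0 ; atStart = atStart₀ ; lag = refl ; c≤k = z≤n }
      where
        atStart₀ : state 0 ≡ atMarker q₀M
        atStart₀ = trans (cong decode (proj₁ (proj₂ comp))) (decode-enc (atMarker q₀M))
    sim (suc k) = proj₁ (block k (sim k))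

    run : ℕ → Config M
    run k = q (sim k) , c (sim k)

    isRun : IsRun M x run
    isRun = refl , λ k → proj₂ (block k (sim k))

    acceptingVisit : ∀ p → accepting (state p) ≡ true → ∃[ k ] (p ≡ hStart k × q (sim k) ∈ FM)
    acceptingVisit p acc with accepting-marker (state p) acc
    ... | q' , st , q'∈F with fromMarker (recast st refl refl (ruleAt p))
    ...   | _ , _ , reads-A , _ =
      k , p≡ , lookup⇒[]= (q (sim k)) FM (subst (λ q → Vec.lookup FM q ≡ true) q'≡ q'∈F)
      where
        k = proj₁ (hLocate p)
        p≡ : p ≡ hStart k
        p≡ = trans (proj₁ (hBlocks.locate-spec p))
                   (trans (cong (hStart k +_) (h-marker-only x p reads-A)) (+-identityʳ (hStart k)))
        q'≡ : q' ≡ q (sim k)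
        q'≡ = atMarker-injective (trans (sym st) (trans (cong state p≡) (atStart (sim k))))
          where
            atMarker-injective : ∀ {q₁ q₂} → atMarker q₁ ≡ atMarker q₂ → q₁ ≡ q₂
            atMarker-injective refl = refl

    visits : ∀ N → ∃[ k ] (N ≤ k × proj₁ (run k) ∈ FM)
    visits N with success (hStart N)
    ... | i , hN≤i , tgt∈F
      with acceptingVisit (suc i) (∈F⇒accepting _ (subst (_∈ F) (proj₂ (proj₂ comp) i) tgt∈F))
    ...   | k , si≡ , q∈F = k , N≤k , q∈F
      where
        N≤k : N ≤ k
        N≤k = ≮⇒≥ (λ k<N → <⇒≱ (≤-<-trans hN≤i (≤-reflexive si≡))
                                (hBlocks.blockStart-mono (<⇒≤ k<N)))

    accepts : Accepts M x
    accepts = run , isRun , visits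

  module Completeness (x : Word (Fin n)) (ρ : ℕ → Config M) (isRun : IsRun M x ρ)
                      (visits : ∀ N → ∃[ i ] (N ≤ i × proj₁ (ρ i) ∈ FM)) where

    counter : ℕ → ℕ
    counter k = proj₂ (ρ k)

    taken : ℕ → Fin m
    taken k = index (proj₁ (proj₂ (proj₂ isRun k)))

    private
      taken≡ : ∀ k → (proj₁ (ρ k) , x k , isPos (counter k) , proj₁ (ρ (suc k)) , proj₁ (proj₂ isRun k))
                     ≡ lookup ΔM (taken k)
      taken≡ k = lookup-index (proj₁ (proj₂ (proj₂ isRun k)))

    src≡ : ∀ k → srcM (taken k) ≡ proj₁ (ρ k)
    src≡ k = sym (cong proj₁ (taken≡ k))

    let≡ : ∀ k → letM (taken k) ≡ x k
    let≡ k = sym (cong (λ e → proj₁ (proj₂ e)) (taken≡ k))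

    test≡ : ∀ k → testM (taken k) ≡ isPos (counter k)
    test≡ k = sym (cong (λ e → proj₁ (proj₂ (proj₂ e))) (taken≡ k))

    chain : ∀ k → tgtM (taken k) ≡ srcM (taken (suc k))
    chain k = trans (sym (cong (λ e → proj₁ (proj₂ (proj₂ (proj₂ e)))) (taken≡ k))) (sym (src≡ (suc k)))

    counter-suc : ∀ k → counter (suc k) ≡ applyMove (movM (taken k)) (counter k)
    counter-suc k = trans (proj₂ (proj₂ (proj₂ isRun k)))
                          (cong (λ e → applyMove (proj₂ (proj₂ (proj₂ (proj₂ e)))) (counter k)) (taken≡ k))

    counter≤ : ∀ k → counter k ≤ k
    counter≤ zero    = ≤-reflexive (cong proj₂ (proj₁ isRun))
    counter≤ (suc k) = ≤-trans (≤-reflexive (counter-suc k))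
                               (≤-trans (applyMove-≤ (movM (taken k)) (counter k)) (s≤s (counter≤ k)))

    dec⇒positive : ∀ k → movM (taken k) ≡ dec → ∃[ c₀ ] counter k ≡ suc c₀
    dec⇒positive k isDec = dec-positive (∈ΔM (taken k) refl refl (test≡ k) isDec)

    stAt : ℕ × ℕ → St
    stAt (k , zero)  = atMarker (srcM (taken k))
    stAt (k , suc j) = if j <ᵇ suc k then reading (taken k) else lastState (taken k) (movM (taken k))

    outAt : ℕ × ℕ → List L
    outAt (k , zero)  = testLetter (testM (taken k)) ∷ []
    outAt (k , suc j) = if j <ᵇ suc k
                        then (if j <ᵇ k then lagLetter (suc j) (counter k) ∷ []
                              else lastZeroOut (movM (taken k)) (lagLetter (suc j) (counter k)))
                        else endOut (movM (taken k))

    blockRule : ∀ k j → j ≤ suc (suc k) →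
                Rule (stAt (k , j)) (hLetter o x k j) (outAt (k , j)) (stAt (hBlocks.next (k , j)))
    blockRule k j j≤ with offset j≤
    ... | atMark = marker (taken k)
    ... | atZero {j'} j'<k rewrite <ᵇ-true (m<n⇒m<1+n j'<k) | <ᵇ-true j'<k = zeroRule (taken k) (suc j') (counter k)
    ... | atLastZero rewrite <ᵇ-true {k} {suc k} ≤-refl | <ᵇ-false {k} {k} ≤-refl =
      lastZeroRule (taken k) (movM (taken k)) (suc k) (counter k) refl
    ... | atLetter rewrite <ᵇ-false {suc k} {suc k} ≤-refl =
      recast refl (cong just (let≡ k)) (cong atMarker (chain k)) (endRule (taken k) (movM (taken k)) refl)

    τ : ℕ → TrT
    τ i = enc (stAt (hLocate i)) , h o x i ∷ [] , outAt (hLocate i) , enc (stAt (hLocate (suc i)))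

    ruleAt : ∀ i → Rule (stAt (hLocate i)) (h o x i) (outAt (hLocate i)) (stAt (hLocate (suc i)))
    ruleAt i = recast refl (sym (h-located x i)) (cong stAt (sym (hBlocks.locate-suc i)))
                      (blockRule (proj₁ (hLocate i)) (proj₂ (hLocate i)) (proj₂ (hBlocks.locate-spec i)))

    computation : IsComputation 𝒯 τ
    computation = (λ i → rule-∈Δ (ruleAt i)) ,
                  cong (λ q → enc (atMarker q)) (trans (src≡ 0) (cong proj₁ (proj₁ isRun))) ,
                  (λ i → refl)

    outPos : ℕ → ℕ
    outPos = prefLen (λ i → out 𝒯 (τ i))

    outPos-in : ∀ k j → j ≤ suc (suc k) → outPos (hStart k + suc j) ≡ outPos (hStart k + j) + length (outAt (k , j))
    outPos-in k j j≤ = trans (cong outPos (+-suc (hStart k) j))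
                             (cong (λ p → outPos (hStart k + j) + length (outAt p)) (hBlocks.locate-at k j j≤))

    writes-one : ∀ k j → j ≤ k → length (outAt (k , j)) ≡ 1
    writes-one k zero    _         = refl
    writes-one k (suc j) j<k rewrite <ᵇ-true (m<n⇒m<1+n j<k) | <ᵇ-true j<k = refl

    outAt-lastZero : ∀ k → outAt (k , suc k) ≡ lastZeroOut (movM (taken k)) (lagLetter (suc k) (counter k))
    outAt-lastZero k rewrite <ᵇ-true {k} {suc k} ≤-refl | <ᵇ-false {k} {k} ≤-refl = refl

    outAt-letter : ∀ k → outAt (k , suc (suc k)) ≡ endOut (movM (taken k))
    outAt-letter k rewrite <ᵇ-false {suc k} {suc k} ≤-refl = refl

    lag-inner : ∀ k → outPos (hStart k) + counter k ≡ αStart k →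
                ∀ j → j ≤ suc k → outPos (hStart k + j) + counter k ≡ αStart k + j
    lag-inner k lag₀ zero    _  = trans (cong (λ p → outPos p + counter k) (+-identityʳ (hStart k)))
                                        (trans lag₀ (sym (+-identityʳ (αStart k))))
    lag-inner k lag₀ (suc j) j< = begin
      outPos (hStart k + suc j) + counter k   ≡⟨ cong (_+ counter k) (outPos-in k j (≤-trans (<⇒≤ j<) (n≤1+n _))) ⟩
      O + length (outAt (k , j)) + counter k  ≡⟨ cong (λ l → O + l + counter k) (writes-one k j (≤-pred j<)) ⟩
      O + 1 + counter k                       ≡⟨ +-assoc O 1 (counter k) ⟩
      O + suc (counter k)                     ≡⟨ +-suc O (counter k) ⟩
      suc (O + counter k)                     ≡⟨ cong suc (lag-inner k lag₀ j (<⇒≤ j<)) ⟩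
      suc (αStart k + j)                      ≡⟨ sym (+-suc (αStart k) j) ⟩
      αStart k + suc j                        ∎
      where
        open ≡-Reasoning
        O = outPos (hStart k + j)

    lastZeroLetter : ℕ → L
    lastZeroLetter k = lagLetter (suc k) (counter k)

    outPos-letter : ∀ k → outPos (hStart k + suc (suc k)) ≡
                          outPos (hStart k + suc k) + length (lastZeroOut (movM (taken k)) (lastZeroLetter k))
    outPos-letter k = trans (outPos-in k (suc k) (n≤1+n _))
                            (cong (λ w → outPos (hStart k + suc k) + length w) (outAt-lastZero k))

    outPos-next : ∀ k → outPos (hStart (suc k)) ≡
                        outPos (hStart k + suc (suc k)) + length (endOut (movM (taken k)))
    outPos-next k = trans (outPos-in k (suc (suc k)) ≤-refl)
                          (cong (λ w → outPos (hStart k + suc (suc k)) + length w) (outAt-letter k))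

    lag : ∀ k → outPos (hStart k) + counter k ≡ αStart k
    lag zero    = cong proj₂ (proj₁ isRun)
    lag (suc k) = begin
      outPos (hStart (suc k)) + counter (suc k)
        ≡⟨ cong₂ _+_ (trans (outPos-next k) (cong (_+ length e) (outPos-letter k))) (counter-suc k) ⟩
      O + length lz + length e + applyMove mv (counter k)   ≡⟨ regroup O (length lz) (length e) _ ⟩
      O + (length lz + length e + applyMove mv (counter k)) ≡⟨ cong (O +_) (balance mv (counter k) (lastZeroLetter k)
                                                                                    (dec⇒positive k)) ⟩
      O + suc (counter k)                                   ≡⟨ +-suc O (counter k) ⟩
      suc (O + counter k)                                   ≡⟨ cong suc (lag-inner k (lag k) (suc k) ≤-refl) ⟩
      suc (αStart k + suc k)                                ≡⟨ sym (+-suc (αStart k) (suc k)) ⟩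
      αStart k + suc (suc k)                                ∎
      where
        open ≡-Reasoning
        O = outPos (hStart k + suc k)
        mv = movM (taken k)
        lz = lastZeroOut mv (lastZeroLetter k)
        e = endOut mv
        regroup : ∀ a b c d → a + b + c + d ≡ a + (b + c + d)
        regroup = solve-∀

    lag-decLetter : ∀ k → movM (taken k) ≡ dec → outPos (hStart k + suc (suc k)) + counter k ≡ αStart (suc k) + 0
    lag-decLetter k isDec = begin
      outPos (hStart k + suc (suc k)) + counter k ≡⟨ cong (_+ counter k) (outPos-letter k) ⟩
      O + length (lastZeroOut (movM (taken k)) (lastZeroLetter k)) + counter k
          ≡⟨ cong (λ mv → O + length (lastZeroOut mv (lastZeroLetter k)) + counter k) isDec ⟩
      O + 1 + counter k                           ≡⟨ +-assoc O 1 (counter k) ⟩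
      O + suc (counter k)                         ≡⟨ +-suc O (counter k) ⟩
      suc (O + counter k)                         ≡⟨ cong suc (lag-inner k (lag k) (suc k) ≤-refl) ⟩
      suc (αStart k + suc k)                      ≡⟨ sym (+-suc (αStart k) (suc k)) ⟩
      αStart k + suc (suc k)                      ≡⟨ sym (+-identityʳ _) ⟩
      αStart (suc k) + 0                          ∎
      where
        open ≡-Reasoning
        O = outPos (hStart k + suc k)

    writesAt-block : ∀ k j → j ≤ suc (suc k) → WritesAt (α o) (outPos (hStart k + j)) (outAt (k , j))
    writesAt-block k j j≤ with offset j≤
    ... | atMark = begin
      α o (outPos (hStart k + 0))    ≡⟨ α-lag (lag-inner k (lag k) 0 z≤n) (counter≤ k) z≤n ⟩
      lagLetter 0 (counter k)        ≡⟨ sym (testLetter-isPos (counter k)) ⟩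
      testLetter (isPos (counter k)) ≡⟨ cong testLetter (sym (test≡ k)) ⟩
      testLetter (testM (taken k))   ∎
      where open ≡-Reasoning
    ... | atZero {j'} j'<k rewrite <ᵇ-true (m<n⇒m<1+n j'<k) | <ᵇ-true j'<k =
      α-lag (lag-inner k (lag k) (suc j') (s≤s (<⇒≤ j'<k))) (counter≤ k) (s≤s (<⇒≤ j'<k))
    ... | atLastZero rewrite outAt-lastZero k =
      lastZero-writes (movM (taken k)) (α-lag (lag-inner k (lag k) (suc k) ≤-refl) (counter≤ k) ≤-refl)
    ... | atLetter rewrite outAt-letter k = letterWrites (movM (taken k)) refl
      where
        letterWrites : ∀ mv → movM (taken k) ≡ mv → WritesAt (α o) (outPos (hStart k + suc (suc k))) (endOut mv)
        letterWrites stay _     = _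
        letterWrites inc  _     = _
        letterWrites dec  isDec with dec⇒positive k isDec
        ... | c₀ , c≡ = trans (α-lag (lag-decLetter k isDec) (m≤n⇒m≤1+n (counter≤ k)) z≤n)
                              (cong (lagLetter 0) c≡)

    outputs : IsConcat (λ i → out 𝒯 (τ i)) (α o)
    outputs = unbounded , λ i → writesAt-agree (outAt (hLocate i)) (writesAt i)
      where
        writesAt : ∀ i → WritesAt (α o) (outPos i) (outAt (hLocate i))
        writesAt i = subst (λ p → WritesAt (α o) (outPos p) (outAt (hLocate i)))
                           (sym (proj₁ (hBlocks.locate-spec i)))
                           (writesAt-block (proj₁ (hLocate i)) (proj₂ (hLocate i)) (proj₂ (hBlocks.locate-spec i)))
        -- block N of α starts after 2N letters, at most N of which are still unwritten
        unbounded : ∀ N → ∃[ i ] (N ≤ outPos i)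
        unbounded N = hStart N , +-cancelʳ-≤ N N (outPos (hStart N)) (begin
          N + N                        ≤⟨ αBlocks.blockStart-≥ (λ _ → ≤-refl) N ⟩
          αStart N                     ≡⟨ sym (lag N) ⟩
          outPos (hStart N) + counter N ≤⟨ +-monoʳ-≤ (outPos (hStart N)) (counter≤ N) ⟩
          outPos (hStart N) + N        ∎)
          where open ≤-Reasoning

    inputs : IsConcat (λ i → inp 𝒯 (τ i)) (h o x)
    inputs = (λ N → N , ≤-reflexive (sym (inPos≡ N))) ,
             λ { i zero (s≤s z≤n) → cong (h o x) (trans (+-identityʳ _) (inPos≡ i)) }
      where
        inPos≡ : ∀ i → prefLen (λ i → inp 𝒯 (τ i)) i ≡ i
        inPos≡ zero    = refl
        inPos≡ (suc i) = trans (cong (_+ 1) (inPos≡ i)) (+-comm i 1)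

    successful : Successful 𝒯 τ
    successful N with visits (suc N)
    ... | suc k , s≤s N≤k , q∈F = i , N≤i , accepting⇒∈F (stAt (hLocate (suc i))) acc
      where
        i = hStart k + suc (suc k)
        N≤i : N ≤ i
        N≤i = ≤-trans N≤k (≤-trans (m≤m+n k k)
                                   (≤-trans (hBlocks.blockStart-≥ (λ k → s≤s (n≤1+n k)) k) (m≤m+n _ _)))
        next≡ : hLocate (suc i) ≡ (suc k , 0)
        next≡ = trans (cong hLocate (trans (sym (+-suc (hStart k) (suc (suc k)))) (sym (+-identityʳ _))))
                      (hBlocks.locate-at (suc k) 0 z≤n)
        acc : accepting (stAt (hLocate (suc i))) ≡ true
        acc = trans (cong (λ p → accepting (stAt p)) next≡)
                    (trans (cong (Vec.lookup FM) (src≡ (suc k))) ([]=⇒lookup q∈F))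

    relates : RelOf 𝒯 (h o x) (α o)
    relates = τ , computation , successful , inputs , outputs

mainTheorem2 : (n : ℕ) (o : Fin n) (M : OneCounter (Fin n)) →
    Σ (Word (Maybe (Fin n)) → Word (Maybe (Fin n)) → Set) λ R₁ →
      InfRational R₁ × (∀ (x : Word (Fin n)) → Accepts M x ⇔ R₁ (h o x) (α o))
mainTheorem2 n o M = RelOf 𝒯 , (𝒯 , λ _ _ → mk⇔ id id) , λ x → mk⇔
    (λ (ρ , isRun , visits) → Completeness.relates x ρ isRun visits)
    (λ (τ , comp , success , inputs , outputs) → Soundness.accepts x τ comp success inputs outputs)
  where open Construction n o M
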